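{- Let $(C,\cdot)$ be a propelinear code of length $4n$ such that $C$ consists of $\mathbf 0$, $\mathbf 1$ and $8n-2$ further codewords, each of Hamming weight $2n$. Then $C$ is a binary Hadamard code.
   Context: Let $\mathbb{F}=\mathbb{Z}_2$. $\mathbf 0,\mathbf 1$ denote the all-zero and all-one vectors; for a permutation $\pi$ of $\{1,\dots,m\}$ and $v\in\mathbb{F}^m$, $\pi(v)=(v_{\pi^{ -1}(1)},\dots,v_{\pi^{ -1}(m)})$. A code $C\subseteq\mathbb{F}^m$ with $\mathbf 0\in C$ is propelinear if to each $x\in C$ a coordinate permutation $\pi_x$ is assigned such that for all $x,y\in C$: $x+\pi_x(y)\in C$ and $\pi_x\pi_y=\pi_{x+\pi_x(y)}$. A binary Hadamard matrix of order $4n$ is obtained from a $4n\times4n$ matrix with entries $\pm1$ and $HH^T=4nI$ by replacing $+1$ by $0$ and $-1$ by $1$; the binary Hadamard code it defines is the set of its rows together with their complements ($8n$ codewords of length $4n$). -}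

module Defs where

open import Data.Nat using (ℕ; zero; suc; _*_)
open import Data.Bool using (Bool; true; false; not; _xor_)
open import Data.Fin using (Fin; zero; suc)
open import Data.Fin.Permutation using (Permutation′; _⟨$⟩ʳ_; _⟨$⟩ˡ_)
open import Data.Vec using (Vec; tabulate; lookup; zipWith; replicate; map; count)
open import Data.Integer using (ℤ; +_; -[1+_]) renaming (_+_ to _+ℤ_; _*_ to _*ℤ_)
open import Data.List using (List)
open import Data.List.Membership.Propositional using (_∈_)
open import Data.Product using (Σ; ∃; _×_; _,_)
open import Data.Sum using (_⊎_)
open import Relation.Binary.PropositionalEquality using (_≡_)
open import Relation.Nullary using (¬_)
open import Relation.Nullary.Decidable using (yes; no)
open import Data.Fin.Properties using (_≟_)
open import Data.Bool.Properties using () renaming (_≟_ to _≟B_)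

-- Binary vectors of length m over F = Z_2 (true = 1, false = 0)
𝔽 : ℕ → Set
𝔽 m = Vec Bool m

𝟎 : ∀ {m} → 𝔽 m
𝟎 = replicate _ false

𝟏 : ∀ {m} → 𝔽 m
𝟏 = replicate _ true

_⊕_ : ∀ {m} → 𝔽 m → 𝔽 m → 𝔽 m
_⊕_ = zipWith _xor_

wt : ∀ {m} → 𝔽 m → ℕ
wt v = count (λ b → b ≟B true) v

act : ∀ {m} → Permutation′ m → 𝔽 m → 𝔽 m
act π v = tabulate (λ i → lookup v (π ⟨$⟩ˡ i))

-- A code C ⊆ F^m given as a duplicate-free list; membership is _∈_.
IsPropelinear : ∀ {m} → List (𝔽 m) → Set
IsPropelinear {m} C =
  𝟎 ∈ C ×
  Σ ((x : 𝔽 m) → x ∈ C → Permutation′ m) λ π →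
    ∀ x y (x∈C : x ∈ C) (y∈C : y ∈ C) →
      Σ ((x ⊕ act (π x x∈C) y) ∈ C) λ z∈C →
        ∀ i → π x x∈C ⟨$⟩ʳ (π y y∈C ⟨$⟩ʳ i) ≡ π (x ⊕ act (π x x∈C) y) z∈C ⟨$⟩ʳ i

∑ : ∀ {k} → (Fin k → ℤ) → ℤ
∑ {zero} f = + 0
∑ {suc k} f = f zero +ℤ ∑ (λ i → f (suc i))

sgn : Bool → ℤ
sgn false = + 1
sgn true = -[1+ 0 ]

IsHadamardPM : ∀ {k} → (Fin k → Fin k → ℤ) → Set
IsHadamardPM {k} H =
  (∀ i j → H i j ≡ + 1 ⊎ H i j ≡ -[1+ 0 ]) ×
  (∀ i j → ∑ (λ l → H i l *ℤ H j l) ≡ (δ i j))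
  where
  δ : Fin k → Fin k → ℤ
  δ i j with i ≟ j
  ... | yes _ = + k
  ... | no _ = + 0

-- binary Hadamard matrix of order k: the 0/1 matrix obtained from a ±1
-- Hadamard matrix by +1 ↦ 0, -1 ↦ 1; equivalently, a 0/1 matrix whose
-- ±1 version (via sgn, the inverse replacement) is Hadamard.
IsBinaryHadamard : ∀ {k} → (Fin k → Fin k → Bool) → Set
IsBinaryHadamard B = IsHadamardPM (λ i j → sgn (B i j))

row : ∀ {k} → (Fin k → Fin k → Bool) → Fin k → 𝔽 k
row B i = tabulate (B i)

IsBinaryHadamardCode : ∀ {k} → List (𝔽 k) → Set
IsBinaryHadamardCode {k} C =
  Σ (Fin k → Fin k → Bool) λ B →
    IsBinaryHadamard B ×
    (∀ v → (v ∈ C → ∃ λ i → v ≡ row B i ⊎ v ≡ map not (row B i)) ×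
           ((∃ λ i → v ≡ row B i ⊎ v ≡ map not (row B i)) → v ∈ C))

-- For x ∈ C the translation z ↦ x + π_x(z) maps C injectively into C, hence onto C,
-- and d(x, x + π_x(z)) = wt(π_x(z)) = wt z. So the distances from any
-- codeword are exactly the codeword weights: translating 𝟏 shows that C is closed
-- under complement, and any two codewords that are neither equal nor complementary
-- are at distance 2n. Keeping from each of the 4n complementary pairs the word with
-- first coordinate 0 gives 4n words at mutual distance 2n, i.e. 4n pairwise
-- orthogonal ±1 vectors of length 4n.
module Submission where

open import Defs
open import Data.Bool using (Bool; true; false; not; _xor_)
open import Data.Bool.Properties
  using (xor-identityˡ; xor-identityʳ; xor-assoc; xor-comm; xor-same; not-involutive; not-¬)
  renaming (_≟_ to _≟B_)
open import Data.Empty using (⊥-elim)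
open import Data.Fin using (Fin; zero; suc; cast)
open import Data.Fin.Permutation as Perm using (Permutation′; _⟨$⟩ʳ_; _⟨$⟩ˡ_)
open import Data.Fin.Properties using (injective⇒≤; cast-involutive) renaming (_≟_ to _≟F_)
open import Data.Integer using (+_; -[1+_]) renaming (_+_ to _+ℤ_; _*_ to _*ℤ_)
open import Data.Integer.Properties using (pos-+; +-0-abelianGroup; +-commutativeSemigroup; +-identityʳ)
open import Data.List using (List; []; _∷_; length; filter) renaming (lookup to lookupL; map to mapL)
open import Data.List.Properties using (length-map)
open import Data.List.Membership.Propositional using (_∈_)
open import Data.List.Membership.Propositional.Properties using (∈-lookup; ∈-map⁻; ∈-filter⁺; ∈-filter⁻)
import Data.List.Membership.DecPropositional as DecMembership
open import Data.List.Relation.Binary.Subset.Propositional using (_⊆_)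
import Data.List.Relation.Unary.All as All
open import Data.List.Relation.Unary.AllPairs using (_∷_)
open import Data.List.Relation.Unary.Any using (here; there; index)
open import Data.List.Relation.Unary.Any.Properties using (lookup-index)
open import Data.List.Relation.Unary.Unique.Propositional using (Unique)
import Data.List.Relation.Unary.Unique.Propositional.Properties as Unique
open import Data.Nat using (ℕ; zero; suc; _+_; _*_; _≤_)
open import Data.Nat.Properties
  using (+-0-commutativeMonoid; *-distribˡ-+; *-assoc; +-suc; <-irrefl; ≤-antisym; *-cancelˡ-≡)
  renaming (+-identityʳ to +ℕ-identityʳ)
open import Data.Product using (∃; _×_; _,_; proj₁; proj₂)
open import Data.Sum using (_⊎_; inj₁; inj₂)
open import Data.Vec using (Vec; []; _∷_; lookup; replicate; map)
open import Data.Vec.Properties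
  using (lookup∘tabulate; tabulate∘lookup; tabulate-cong; lookup-replicate; lookup-map; lookup-zipWith;
         zipWith-assoc; zipWith-identityˡ; zipWith-identityʳ; map-∘; map-cong; map-id; ≡-dec)
open import Function using (_∘_)
open import Function.Definitions using (Injective)
open import Relation.Binary.Definitions using (DecidableEquality)
open import Relation.Binary.PropositionalEquality
open import Relation.Nullary using (¬_; yes; no; does)
open import Relation.Unary using (Pred; Decidable)
open import Relation.Unary.Properties using (∁?)
open import Algebra.Properties.AbelianGroup +-0-abelianGroup using (identityˡ-unique)
open import Algebra.Properties.CommutativeMonoid.Sum +-0-commutativeMonoid using (sum; sum-permute; sum-cong-≗)
open import Algebra.Properties.CommutativeSemigroup +-commutativeSemigroup
  using () renaming (interchange to +ℤ-interchange)

lookup-≗⇒≡ : ∀ {A : Set} {m} {u v : Vec A m} → (∀ i → lookup u i ≡ lookup v i) → u ≡ v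
lookup-≗⇒≡ {u = u} {v} eq = trans (sym (tabulate∘lookup u)) (trans (tabulate-cong eq) (tabulate∘lookup v))

module _ {m : ℕ} where

  ⊕-identityʳ : (x : 𝔽 m) → x ⊕ 𝟎 ≡ x
  ⊕-identityʳ = zipWith-identityʳ xor-identityʳ

  ⊕-self : (x : 𝔽 m) → x ⊕ x ≡ 𝟎
  ⊕-self x = lookup-≗⇒≡ λ i → begin
    lookup (x ⊕ x) i               ≡⟨ lookup-zipWith _xor_ i x x ⟩
    lookup x i xor lookup x i      ≡⟨ xor-same (lookup x i) ⟩
    false                          ≡⟨ lookup-replicate i false ⟨
    lookup 𝟎 i                     ∎
    where open ≡-Reasoning

  ⊕-cancelˡ : (x w : 𝔽 m) → x ⊕ (x ⊕ w) ≡ w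
  ⊕-cancelˡ x w = begin
    x ⊕ (x ⊕ w)  ≡⟨ zipWith-assoc xor-assoc x x w ⟨
    (x ⊕ x) ⊕ w  ≡⟨ cong (_⊕ w) (⊕-self x) ⟩
    𝟎 ⊕ w        ≡⟨ zipWith-identityˡ xor-identityˡ w ⟩
    w            ∎
    where open ≡-Reasoning

  ⊕-injectiveˡ : (x : 𝔽 m) {a b : 𝔽 m} → x ⊕ a ≡ x ⊕ b → a ≡ b
  ⊕-injectiveˡ x {a} {b} eq = trans (sym (⊕-cancelˡ x a)) (trans (cong (x ⊕_) eq) (⊕-cancelˡ x b))

  ⊕-𝟏 : (x : 𝔽 m) → x ⊕ 𝟏 ≡ map not x
  ⊕-𝟏 x = lookup-≗⇒≡ λ i → begin
    lookup (x ⊕ 𝟏) i                ≡⟨ lookup-zipWith _xor_ i x 𝟏 ⟩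
    lookup x i xor lookup 𝟏 i       ≡⟨ cong (lookup x i xor_) (lookup-replicate i true) ⟩
    lookup x i xor true             ≡⟨ xor-comm (lookup x i) true ⟩
    not (lookup x i)                ≡⟨ lookup-map i not x ⟨
    lookup (map not x) i            ∎
    where open ≡-Reasoning

  map-not-involutive : (x : 𝔽 m) → map not (map not x) ≡ x
  map-not-involutive x = trans (sym (map-∘ not not x)) (trans (map-cong not-involutive x) (map-id x))

  map-not-injective : {a b : 𝔽 m} → map not a ≡ map not b → a ≡ b
  map-not-injective {a} {b} eq =
    trans (sym (map-not-involutive a)) (trans (cong (map not) eq) (map-not-involutive b))

  act-replicate : (π : Permutation′ m) (b : Bool) → act π (replicate m b) ≡ replicate m b
  act-replicate π b = lookup-≗⇒≡ λ i →
    trans (lookup∘tabulate _ i) (trans (lookup-replicate (π ⟨$⟩ˡ i) b) (sym (lookup-replicate i b)))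

  act-injective : (π : Permutation′ m) {a b : 𝔽 m} → act π a ≡ act π b → a ≡ b
  act-injective π {a} {b} eq = lookup-≗⇒≡ λ i → begin
    lookup a i                               ≡⟨ cong (lookup a) (Perm.inverseˡ π) ⟨
    lookup a (π ⟨$⟩ˡ (π ⟨$⟩ʳ i))             ≡⟨ lookup∘tabulate _ (π ⟨$⟩ʳ i) ⟨
    lookup (act π a) (π ⟨$⟩ʳ i)              ≡⟨ cong (λ v → lookup v (π ⟨$⟩ʳ i)) eq ⟩
    lookup (act π b) (π ⟨$⟩ʳ i)              ≡⟨ lookup∘tabulate _ (π ⟨$⟩ʳ i) ⟩
    lookup b (π ⟨$⟩ˡ (π ⟨$⟩ʳ i))             ≡⟨ cong (lookup b) (Perm.inverseˡ π) ⟩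
    lookup b i                               ∎
    where open ≡-Reasoning

bit : Bool → ℕ
bit false = 0
bit true = 1

wt-∷ : ∀ {m} (b : Bool) (v : 𝔽 m) → wt (b ∷ v) ≡ bit b + wt v
wt-∷ false v = refl
wt-∷ true v = refl

wt-𝟎 : ∀ {m} → wt (𝟎 {m}) ≡ 0
wt-𝟎 {zero} = refl
wt-𝟎 {suc m} = wt-𝟎 {m}

wt≡sum : ∀ {m} (v : 𝔽 m) → wt v ≡ sum (bit ∘ lookup v)
wt≡sum [] = refl
wt≡sum (b ∷ v) = trans (wt-∷ b v) (cong (_+_ (bit b)) (wt≡sum v))

wt-act : ∀ {m} (π : Permutation′ m) (v : 𝔽 m) → wt (act π v) ≡ wt v
wt-act {m} π v = begin
  wt (act π v)                          ≡⟨ wt≡sum (act π v) ⟩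
  sum (bit ∘ lookup (act π v))          ≡⟨ sum-cong-≗ {m} (λ i → cong bit (lookup∘tabulate _ i)) ⟩
  sum (λ i → bit (lookup v (π ⟨$⟩ˡ i)))  ≡⟨ sum-permute (bit ∘ lookup v) (Perm.flip π) ⟨
  sum (bit ∘ lookup v)                  ≡⟨ wt≡sum v ⟨
  wt v                                  ∎
  where open ≡-Reasoning

bit-correlation : (a b : Bool) → sgn a *ℤ sgn b +ℤ + (2 * bit (a xor b)) ≡ + 1
bit-correlation false false = refl
bit-correlation false true = refl
bit-correlation true false = refl
bit-correlation true true = refl

-- The ±1 inner product of u and v is m − 2 d(u, v), written without subtraction.
correlation : ∀ {m} (u v : 𝔽 m) →
  ∑ (λ l → sgn (lookup u l) *ℤ sgn (lookup v l)) +ℤ + (2 * wt (u ⊕ v)) ≡ + m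
correlation [] [] = refl
correlation {suc m} (a ∷ u) (b ∷ v) = begin
  (p +ℤ s) +ℤ + (2 * wt ((a xor b) ∷ (u ⊕ v)))  ≡⟨ cong (λ w → (p +ℤ s) +ℤ + (2 * w)) (wt-∷ (a xor b) (u ⊕ v)) ⟩
  (p +ℤ s) +ℤ + (2 * (t + d))                   ≡⟨ cong ((p +ℤ s) +ℤ_) twice-distrib ⟩
  (p +ℤ s) +ℤ (+ (2 * t) +ℤ + (2 * d))          ≡⟨ +ℤ-interchange p s _ _ ⟩
  (p +ℤ + (2 * t)) +ℤ (s +ℤ + (2 * d))          ≡⟨ cong₂ _+ℤ_ (bit-correlation a b) (correlation u v) ⟩
  + suc m                                       ∎
  where
  open ≡-Reasoning
  p = sgn a *ℤ sgn b
  s = ∑ (λ l → sgn (lookup u l) *ℤ sgn (lookup v l))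
  t = bit (a xor b)
  d = wt (u ⊕ v)
  twice-distrib : + (2 * (t + d)) ≡ + (2 * t) +ℤ + (2 * d)
  twice-distrib = trans (cong +_ (*-distribˡ-+ 2 t d)) (pos-+ (2 * t) (2 * d))

module _ {A : Set} where

  Unique⇒lookup-injective : {xs : List A} → Unique xs → Injective _≡_ _≡_ (lookupL xs)
  Unique⇒lookup-injective (_ ∷ _) {zero} {zero} _ = refl
  Unique⇒lookup-injective (x∉xs ∷ _) {zero} {suc j} eq = ⊥-elim (All.lookup x∉xs (∈-lookup j) eq)
  Unique⇒lookup-injective (x∉xs ∷ _) {suc i} {zero} eq = ⊥-elim (All.lookup x∉xs (∈-lookup i) (sym eq))
  Unique⇒lookup-injective (_ ∷ u) {suc i} {suc j} eq = cong suc (Unique⇒lookup-injective u eq)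

  Unique-⊆⇒length-≤ : {xs ys : List A} → Unique xs → xs ⊆ ys → length xs ≤ length ys
  Unique-⊆⇒length-≤ {xs} {ys} u xs⊆ys = injective⇒≤ {f = position} position-injective
    where
    position : Fin (length xs) → Fin (length ys)
    position i = index (xs⊆ys (∈-lookup i))
    position-injective : Injective _≡_ _≡_ position
    position-injective {i} {j} eq = Unique⇒lookup-injective u (begin
      lookupL xs i             ≡⟨ lookup-index (xs⊆ys (∈-lookup i)) ⟩
      lookupL ys (position i)  ≡⟨ cong (lookupL ys) eq ⟩
      lookupL ys (position j)  ≡⟨ lookup-index (xs⊆ys (∈-lookup j)) ⟨
      lookupL xs j             ∎)
      where open ≡-Reasoning

  Unique-⊆-≡length⇒⊇ : DecidableEquality A → {xs ys : List A} →
    Unique xs → xs ⊆ ys → length xs ≡ length ys → ys ⊆ xs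
  Unique-⊆-≡length⇒⊇ _≟_ {xs} {ys} u xs⊆ys len {y} y∈ys with DecMembership._∈?_ _≟_ y xs
  ... | yes y∈xs = y∈xs
  ... | no y∉xs = ⊥-elim (<-irrefl len (Unique-⊆⇒length-≤ (All.tabulate y≢ ∷ u) y∷xs⊆ys))
    where
    y≢ : ∀ {x} → x ∈ xs → y ≢ x
    y≢ x∈xs refl = y∉xs x∈xs
    y∷xs⊆ys : (y ∷ xs) ⊆ ys
    y∷xs⊆ys (here refl) = y∈ys
    y∷xs⊆ys (there x∈xs) = xs⊆ys x∈xs

  module _ {ℓ} {P : Pred A ℓ} (P? : Decidable P) where

    length-filter-∁ : (xs : List A) → length (filter P? xs) + length (filter (∁? P?) xs) ≡ length xs
    length-filter-∁ [] = refl
    length-filter-∁ (x ∷ xs) with does (P? x)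
    ... | true = cong suc (length-filter-∁ xs)
    ... | false = trans (+-suc _ _) (cong suc (length-filter-∁ xs))

    length-filter-≤-injection : ∀ {ℓ′} {Q : Pred A ℓ′} (Q? : Decidable Q) {f : A → A} {xs : List A} →
      Injective _≡_ _≡_ f → Unique xs → (∀ {x} → x ∈ xs → f x ∈ xs) → (∀ {x} → P x → Q (f x)) →
      length (filter P? xs) ≤ length (filter Q? xs)
    length-filter-≤-injection Q? {f} {xs} f-inj u f-closed f-PQ =
      subst (_≤ length (filter Q? xs)) (length-map f (filter P? xs))
        (Unique-⊆⇒length-≤ (Unique.map⁺ f-inj (Unique.filter⁺ P? u)) image⊆)
      where
      image⊆ : mapL f (filter P? xs) ⊆ filter Q? xs
      image⊆ y∈ with ∈-map⁻ f y∈
      ... | x , x∈ , refl with ∈-filter⁻ P? x∈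
      ... | x∈xs , Px = ∈-filter⁺ Q? (f-closed x∈xs) (f-PQ Px)

module AntipodalEquidistant {m} (i₀ : Fin m) {C : List (𝔽 m)} (uC : Unique C)
  (length-C : length C ≡ 2 * m)
  (complement∈ : ∀ {x} → x ∈ C → map not x ∈ C)
  (equidistant : ∀ {x y} → x ∈ C → y ∈ C → y ≢ x → y ≢ map not x → 2 * wt (x ⊕ y) ≡ m) where

  Normalised : Pred (𝔽 m) _
  Normalised v = lookup v i₀ ≡ false

  normalised? : Decidable Normalised
  normalised? v = lookup v i₀ ≟B false

  lookup-complement : (v : 𝔽 m) → lookup (map not v) i₀ ≡ not (lookup v i₀)
  lookup-complement v = lookup-map i₀ not v

  complement-normalised : ∀ v → ¬ Normalised v → Normalised (map not v)
  complement-normalised v ¬n with lookup v i₀ | lookup-complement v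
  ... | true | eq = eq
  ... | false | _ = ⊥-elim (¬n refl)

  complement-not-normalised : ∀ v → Normalised v → ¬ Normalised (map not v)
  complement-not-normalised v n eq = not-¬ refl (trans (sym (cong not n)) (trans (sym (lookup-complement v)) eq))

  N : List (𝔽 m)
  N = filter normalised? C

  length-N : length N ≡ m
  length-N = *-cancelˡ-≡ (length N) m 2 (begin
    2 * length N                    ≡⟨ cong (_+_ (length N)) (+ℕ-identityʳ (length N)) ⟩
    length N + length N             ≡⟨ cong (_+_ (length N)) (≤-antisym N≤N̄ N̄≤N) ⟩
    length N + length N̄             ≡⟨ length-filter-∁ normalised? C ⟩
    length C                        ≡⟨ length-C ⟩
    2 * m                           ∎)
    where
    open ≡-Reasoning
    N̄ = filter (∁? normalised?) C
    N≤N̄ : length N ≤ length N̄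
    N≤N̄ = length-filter-≤-injection normalised? (∁? normalised?) map-not-injective uC complement∈
            (λ {v} → complement-not-normalised v)
    N̄≤N : length N̄ ≤ length N
    N̄≤N = length-filter-≤-injection (∁? normalised?) normalised? map-not-injective uC complement∈
            (λ {v} → complement-normalised v)

  row-of : Fin m → 𝔽 m
  row-of i = lookupL N (cast (sym length-N) i)

  B : Fin m → Fin m → Bool
  B i = lookup (row-of i)

  row-B : ∀ i → row B i ≡ row-of i
  row-B i = tabulate∘lookup (row-of i)

  row-of∈N : ∀ i → row-of i ∈ N
  row-of∈N i = ∈-lookup (cast (sym length-N) i)

  row-of∈C : ∀ i → row-of i ∈ C
  row-of∈C i = proj₁ (∈-filter⁻ normalised? {xs = C} (row-of∈N i))

  row-of-normalised : ∀ i → Normalised (row-of i)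
  row-of-normalised i = proj₂ (∈-filter⁻ normalised? {xs = C} (row-of∈N i))

  row-of-injective : Injective _≡_ _≡_ row-of
  row-of-injective {i} {j} eq = begin
    i                                      ≡⟨ cast-involutive length-N (sym length-N) i ⟨
    cast length-N (cast (sym length-N) i)  ≡⟨ cong (cast length-N) (lookup-N-injective eq) ⟩
    cast length-N (cast (sym length-N) j)  ≡⟨ cast-involutive length-N (sym length-N) j ⟩
    j                                      ∎
    where
    open ≡-Reasoning
    lookup-N-injective : Injective _≡_ _≡_ (lookupL N)
    lookup-N-injective = Unique⇒lookup-injective (Unique.filter⁺ normalised? uC)

  N⊆rows : ∀ {w} → w ∈ N → ∃ λ i → w ≡ row-of i
  N⊆rows w∈N = cast length-N (index w∈N) ,
    trans (lookup-index w∈N) (cong (lookupL N) (sym (cast-involutive (sym length-N) length-N (index w∈N))))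

  sgn-±1 : ∀ b → sgn b ≡ + 1 ⊎ sgn b ≡ -[1+ 0 ]
  sgn-±1 false = inj₁ refl
  sgn-±1 true = inj₂ refl

  row-norm : ∀ i → ∑ (λ l → sgn (B i l) *ℤ sgn (B i l)) ≡ + m
  row-norm i = begin
    s                              ≡⟨ +-identityʳ s ⟨
    s +ℤ + (2 * 0)                 ≡⟨ cong (λ k → s +ℤ + (2 * k)) (trans (cong wt (⊕-self x)) (wt-𝟎 {m})) ⟨
    s +ℤ + (2 * wt (x ⊕ x))        ≡⟨ correlation x x ⟩
    + m                            ∎
    where
    open ≡-Reasoning
    x = row-of i
    s = ∑ (λ l → sgn (B i l) *ℤ sgn (B i l))

  rows-orthogonal : ∀ i j → i ≢ j → ∑ (λ l → sgn (B i l) *ℤ sgn (B j l)) ≡ + 0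
  rows-orthogonal i j i≢j = identityˡ-unique s (+ m) (begin
    s +ℤ + m                      ≡⟨ cong (λ k → s +ℤ + k) (equidistant (row-of∈C i) (row-of∈C j) y≢x y≢x̄) ⟨
    s +ℤ + (2 * wt (x ⊕ y))       ≡⟨ correlation x y ⟩
    + m                           ∎)
    where
    open ≡-Reasoning
    x = row-of i
    y = row-of j
    s = ∑ (λ l → sgn (B i l) *ℤ sgn (B j l))
    y≢x : y ≢ x
    y≢x eq = i≢j (sym (row-of-injective eq))
    y≢x̄ : y ≢ map not x
    y≢x̄ eq = complement-not-normalised x (row-of-normalised i) (subst Normalised eq (row-of-normalised j))

  isBinaryHadamard : IsBinaryHadamard B
  proj₁ isBinaryHadamard i j = sgn-±1 (B i j)
  proj₂ isBinaryHadamard i j with i ≟F j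
  ... | yes refl = row-norm i
  ... | no i≢j = rows-orthogonal i j i≢j

  C⊆rows : ∀ {v} → v ∈ C → ∃ λ i → v ≡ row B i ⊎ v ≡ map not (row B i)
  C⊆rows {v} v∈C with normalised? v
  ... | yes n = let (i , eq) = N⊆rows (∈-filter⁺ normalised? v∈C n) in
    i , inj₁ (trans eq (sym (row-B i)))
  ... | no ¬n = let (i , eq) = N⊆rows (∈-filter⁺ normalised? (complement∈ v∈C) (complement-normalised v ¬n)) in
    i , inj₂ (trans (sym (map-not-involutive v)) (cong (map not) (trans eq (sym (row-B i)))))

  rows⊆C : ∀ {v} → (∃ λ i → v ≡ row B i ⊎ v ≡ map not (row B i)) → v ∈ C
  rows⊆C (i , inj₁ refl) = subst (_∈ C) (sym (row-B i)) (row-of∈C i)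
  rows⊆C (i , inj₂ refl) = complement∈ (subst (_∈ C) (sym (row-B i)) (row-of∈C i))

  isBinaryHadamardCode : IsBinaryHadamardCode C
  isBinaryHadamardCode = B , isBinaryHadamard , λ _ → C⊆rows , rows⊆C

-- Only the closure x + π_x(y) ∈ C of a propelinear structure is needed, not the
-- composition law π_x π_y = π_{x + π_x(y)}.
module Translation {m} {C : List (𝔽 m)} (uC : Unique C)
  (π : (x : 𝔽 m) → x ∈ C → Permutation′ m)
  (closed : ∀ {x y} (x∈C : x ∈ C) → y ∈ C → x ⊕ act (π x x∈C) y ∈ C) where

  translate-surjective : ∀ {x y} (x∈C : x ∈ C) → y ∈ C → ∃ λ z → z ∈ C × y ≡ x ⊕ act (π x x∈C) z
  translate-surjective {x} x∈C y∈C =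
    ∈-map⁻ τ (Unique-⊆-≡length⇒⊇ (≡-dec _≟B_) (Unique.map⁺ τ-injective uC) image⊆C (length-map τ C) y∈C)
    where
    τ : 𝔽 m → 𝔽 m
    τ z = x ⊕ act (π x x∈C) z
    τ-injective : Injective _≡_ _≡_ τ
    τ-injective = act-injective (π x x∈C) ∘ ⊕-injectiveˡ x
    image⊆C : mapL τ C ⊆ C
    image⊆C w∈ with ∈-map⁻ τ w∈
    ... | z , z∈C , refl = closed x∈C z∈C

  complement∈ : 𝟏 ∈ C → ∀ {x} → x ∈ C → map not x ∈ C
  complement∈ 𝟏∈C {x} x∈C =
    subst (_∈ C) (trans (cong (x ⊕_) (act-replicate (π x x∈C) true)) (⊕-𝟏 x)) (closed x∈C 𝟏∈C)

  equidistant : ∀ {d} → (∀ c → c ∈ C → c ≡ 𝟎 ⊎ c ≡ 𝟏 ⊎ wt c ≡ d) →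
    ∀ {x y} → x ∈ C → y ∈ C → y ≢ x → y ≢ map not x → wt (x ⊕ y) ≡ d
  equidistant weights {x} x∈C y∈C y≢x y≢x̄ with translate-surjective x∈C y∈C
  ... | z , z∈C , refl with weights z z∈C
  ... | inj₁ refl = ⊥-elim (y≢x (trans (cong (x ⊕_) (act-replicate (π x x∈C) false)) (⊕-identityʳ x)))
  ... | inj₂ (inj₁ refl) = ⊥-elim (y≢x̄ (trans (cong (x ⊕_) (act-replicate (π x x∈C) true)) (⊕-𝟏 x)))
  ... | inj₂ (inj₂ wt-z) = trans (cong wt (⊕-cancelˡ x _)) (trans (wt-act (π x x∈C) z) wt-z)

lemma5 : (n : ℕ) (C : List (𝔽 (4 * n))) →
    Unique C →
    IsPropelinear C →
    length C ≡ 8 * n →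
    𝟎 ∈ C →
    𝟏 ∈ C →
    (∀ c → c ∈ C → c ≡ 𝟎 ⊎ c ≡ 𝟏 ⊎ wt c ≡ 2 * n) →
    IsBinaryHadamardCode C
lemma5 zero [] _ _ _ () _ _
lemma5 zero (_ ∷ _) _ _ () _ _ _
lemma5 n@(suc _) C uC (_ , π , propelinear) length-C _ 𝟏∈C weights =
  AntipodalEquidistant.isBinaryHadamardCode zero uC (trans length-C (*-assoc 2 4 n)) (complement∈ 𝟏∈C) distance
  where
  open Translation uC π (λ x∈C y∈C → proj₁ (propelinear _ _ x∈C y∈C))
  distance : ∀ {x y} → x ∈ C → y ∈ C → y ≢ x → y ≢ map not x → 2 * wt (x ⊕ y) ≡ 4 * n
  distance x∈C y∈C y≢x y≢x̄ = trans (cong (2 *_) (equidistant weights x∈C y∈C y≢x y≢x̄)) (sym (*-assoc 2 2 n))
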